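{- Fix an integer $k\ge1$. Form a random graph on $n$ vertices by connecting each vertex (by undirected edges) to exactly $k$ other vertices chosen uniformly at random. Then there is a constant $C_k$ depending only on $k$ such that $$\mathbb{P}\left(\text{the graph is disconnected}\right)\le \frac{C_k}{n^{(k-1)(k+1)}}.$$ -}

module Defs where

open import Data.Nat using (ℕ; zero; suc)
open import Data.Bool using (true; false)
open import Data.Fin using (Fin)
open import Data.Fin.Subset using (Subset; _∈_; _∉_; ∣_∣; inside; outside)
open import Data.Fin.Subset.Properties using (_∈?_)
open import Data.Fin.Properties using (all?)
open import Data.Vec using (Vec; []; _∷_; lookup)
open import Data.List using (List; [_]; map; _++_; concatMap)
open import Data.Product using (_×_)
open import Data.Sum using (_⊎_)
open import Relation.Nullary using (¬_; Dec)
open import Relation.Nullary.Decidable using (_×-dec_; ¬?)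
open import Relation.Binary.PropositionalEquality using (_≡_)
import Data.Nat as ℕ

-- A configuration of the random k-out graph on vertex set Fin n:
-- vertex v chooses the set (lookup c v) of its out-neighbours.
Config : ℕ → Set
Config n = Vec (Subset n) n

Valid : ∀ {n} → ℕ → Config n → Set
Valid {n} k c = ∀ (v : Fin n) → (v ∉ lookup c v) × (∣ lookup c v ∣ ≡ k)

valid? : ∀ {n} (k : ℕ) (c : Config n) → Dec (Valid k c)
valid? k c = all? (λ v → ¬? (v ∈? lookup c v) ×-dec (∣ lookup c v ∣ ℕ.≟ k))

Adj : ∀ {n} → Config n → Fin n → Fin n → Set
Adj c u v = (v ∈ lookup c u) ⊎ (u ∈ lookup c v)

data Reach {n} (c : Config n) : Fin n → Fin n → Set where
  here : ∀ {u} → Reach c u u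
  step : ∀ {u v w} → Adj c u v → Reach c v w → Reach c u w

Connected : ∀ {n} → Config n → Set
Connected {n} c = ∀ (u v : Fin n) → Reach c u v

-- Enumeration of all subsets and all configurations (each listed exactly once).
allSubsets : ∀ n → List (Subset n)
allSubsets zero = [ [] ]
allSubsets (suc n) = map (outside ∷_) (allSubsets n) ++ map (inside ∷_) (allSubsets n)

allVecs : ∀ {A : Set} → List A → ∀ m → List (Vec A m)
allVecs xs zero = [ [] ]
allVecs xs (suc m) = concatMap (λ x → map (x ∷_) (allVecs xs m)) xs

allConfigs : ∀ n → List (Config n)
allConfigs n = allVecs (allSubsets n) n

-- A disconnected configuration has a closed set S with 0 < ∣S∣ = s < n (a union of
-- components), so every vertex chooses its k neighbours on its own side of the split
-- {S, ∁ S}: for a fixed S at most C(s-1,k)^s C(t-1,k)^t configurations, t = n - s,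
-- out of C(n-1,k)^n in total. Since C(s-1,k)/C(n-1,k) ≤ (s/n)^k and C(n,s) s^s t^t ≤ n^n,
-- the C(n,s) sets of size s together have proportion at most (s^s t^t/n^n)^(k-1).
-- This vanishes unless s, t > k, and s^s t^t n^q ≤ q^q 2^q n^n when s, t ≥ q: taking
-- q = k+1 for the at most two sizes with min(s,t) = k+1 and q = k+2 for the others
-- bounds the sum over all sizes by a constant times n^-((k-1)(k+1)).

module Submission where

open import Defs

open import Data.Bool using (true; false)
open import Data.Fin using (Fin; zero; suc; _≟_)
open import Data.Fin.Properties using (all?; any?)
open import Data.Fin.Subset using (Subset; _∈_; _∉_; _⊆_; ∣_∣; inside; outside; ⁅_⁆; ∁; _-_)
open import Data.Fin.Subset.Properties
  using (_∈?_; _⊆?_; ∈⊤; ∣p∣≡n⇒p≡⊤; ∣p∣≤n; p⊂q⇒∣p∣<∣q∣; p⊆q⇒∣p∣≤∣q∣; x∈⁅x⁆; x∈⁅y⁆⇒x≡y; x≢y⇒x∉⁅y⁆;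
         ∣⁅x⁆∣≡1; x∉p⇒x∈∁p; x∈p⇒x∉∁p; ∣∁p∣≡n∸∣p∣; x∈p∧x≢y⇒x∈p-y; x∈p⇒∣p-x∣<∣p∣)
open import Data.List using (List; []; _∷_; _++_; map; filter; concatMap; length; upTo)
open import Data.List.Properties using (length-upTo; length-++; filter-++; filter-≐; filter-none; filter-accept; map-upTo)
import Data.List.Membership.Propositional as List
open import Data.List.Membership.Propositional using (lose)
open import Data.List.Membership.Propositional.Properties using (∈-map⁺; ∈-++⁺ˡ; ∈-++⁺ʳ; ∈-concatMap⁺; ∈-filter⁺; ∈-upTo⁺)
open import Data.List.Relation.Unary.All using (All; []; _∷_)
import Data.List.Relation.Unary.All as All
open import Data.List.Relation.Unary.Unique.Propositional.Properties using (upTo⁺; map⁺)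
open import Data.List.Relation.Unary.AllPairs using ([]; _∷_)
open import Data.List.Relation.Unary.Any using (here; there)
open import Data.List.Relation.Unary.Unique.Propositional using (Unique)
open import Data.Nat using (ℕ; zero; suc; _+_; _*_; _^_; _∸_; _≤_; _<_; z≤n; s≤s; _!; _≤?_; NonZero; >-nonZero)
import Data.Nat as ℕ
open import Data.Nat.Combinatorics using (_C_; nCn≡1; nCk+nC[k+1]≡[n+1]C[k+1]; nCk≡nPk/k!; k>n⇒nCk≡0)
open import Data.Nat.Combinatorics.Base using (_P′_)
open import Data.Nat.Combinatorics.Specification using (nPk≡n!/[n∸k]!; nP′k≡n!/[n∸k]!; k!∣nP′k)
open import Data.Nat.DivMod using (_/_; m/n*n≡m)
open import Data.Nat.Properties hiding (_≟_; _≤?_)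
open import Data.Nat.Tactic.RingSolver using (solve-∀)
open import Data.Product using (_×_; _,_; proj₁; proj₂; ∃-syntax)
open import Data.Sum using (_⊎_; inj₁; inj₂)
open import Data.Vec using (Vec; []; _∷_; lookup; tabulate; here; there)
open import Data.Vec.Properties using (lookup∘tabulate; []=⇒lookup; lookup⇒[]=)
open import Function using (_∘_; id; case_of_; _⇔_; mk⇔; Equivalence)
open import Relation.Nullary using (¬_; Dec; yes; no; does; contradiction)
open import Relation.Nullary.Decidable using (_×-dec_; _⊎-dec_; ¬?)
open import Relation.Unary using (Pred; Decidable)
open import Relation.Binary.PropositionalEquality
open import Algebra.Properties.CommutativeSemigroup +-commutativeSemigroup
  using () renaming (interchange to +-interchange)
open import Algebra.Properties.CommutativeSemigroup *-commutativeSemigroup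
  using () renaming (interchange to *-interchange; x∙yz≈y∙xz to x*[y*z]≡y*[x*z]; xy∙z≈xz∙y to x*y*z≡x*z*y)

-- Finite sums and counting

∑ : {A : Set} → List A → (A → ℕ) → ℕ
∑ []       f = 0
∑ (x ∷ xs) f = f x + ∑ xs f

infixl 10 ∑
syntax ∑ xs (λ x → e) = ∑[ x ∈ xs ] e

module _ {A : Set} where

  ∑-++ : ∀ (xs ys : List A) f → ∑ (xs ++ ys) f ≡ ∑ xs f + ∑ ys f
  ∑-++ []       ys f = refl
  ∑-++ (x ∷ xs) ys f = trans (cong (f x +_) (∑-++ xs ys f)) (sym (+-assoc (f x) _ _))

  ∑-map : ∀ {B : Set} (g : A → B) (xs : List A) f → ∑ (map g xs) f ≡ ∑ xs (f ∘ g)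
  ∑-map g []       f = refl
  ∑-map g (x ∷ xs) f = cong (f (g x) +_) (∑-map g xs f)

  ∑-cong : ∀ (xs : List A) {f g} → (∀ x → f x ≡ g x) → ∑ xs f ≡ ∑ xs g
  ∑-cong []       f≗g = refl
  ∑-cong (x ∷ xs) f≗g = cong₂ _+_ (f≗g x) (∑-cong xs f≗g)

  ∑-mono : ∀ (xs : List A) {f g} → (∀ x → f x ≤ g x) → ∑ xs f ≤ ∑ xs g
  ∑-mono []       f≤g = z≤n
  ∑-mono (x ∷ xs) f≤g = +-mono-≤ (f≤g x) (∑-mono xs f≤g)

  term≤∑ : ∀ {xs : List A} {x} f → x List.∈ xs → f x ≤ ∑ xs f
  term≤∑ f (here refl)  = m≤m+n (f _) _
  term≤∑ f (there x∈xs) = ≤-trans (term≤∑ f x∈xs) (m≤n+m _ (f _))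

  ∑-+ : ∀ (xs : List A) f g → ∑[ x ∈ xs ] (f x + g x) ≡ ∑ xs f + ∑ xs g
  ∑-+ []       f g = refl
  ∑-+ (x ∷ xs) f g = trans (cong (f x + g x +_) (∑-+ xs f g)) (+-interchange (f x) (g x) _ _)

  *-distribˡ-∑ : ∀ c (xs : List A) f → c * ∑ xs f ≡ ∑[ x ∈ xs ] (c * f x)
  *-distribˡ-∑ c []       f = *-zeroʳ c
  *-distribˡ-∑ c (x ∷ xs) f = trans (*-distribˡ-+ c (f x) _) (cong (c * f x +_) (*-distribˡ-∑ c xs f))

  ∑-const : ∀ (xs : List A) c → ∑[ x ∈ xs ] c ≡ length xs * c
  ∑-const []       c = refl
  ∑-const (x ∷ xs) c = cong (c +_) (∑-const xs c)

  ∑-filter≤ : ∀ {p} {P : Pred A p} (P? : Decidable P) xs {f g} → (∀ {x} → P x → f x ≤ g x) → ∑ (filter P? xs) f ≤ ∑ xs g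
  ∑-filter≤ P? []       f≤g = z≤n
  ∑-filter≤ P? (x ∷ xs) {f} {g} f≤g with P? x
  ... | yes px = +-mono-≤ (f≤g px) (∑-filter≤ P? xs f≤g)
  ... | no  _  = ≤-trans (∑-filter≤ P? xs f≤g) (m≤n+m _ (g x))

  length-concatMap : ∀ {B : Set} (f : A → List B) xs → length (concatMap f xs) ≡ ∑[ x ∈ xs ] length (f x)
  length-concatMap f []       = refl
  length-concatMap f (x ∷ xs) = trans (length-++ (f x)) (cong (length (f x) +_) (length-concatMap f xs))

∑-upTo-suc : ∀ N g → ∑[ s ∈ upTo (suc N) ] g s ≡ g 0 + ∑[ s ∈ upTo N ] g (suc s)
∑-upTo-suc N g = cong (g 0 +_) (trans (cong (λ ss → ∑ ss g) (sym (map-upTo suc N))) (∑-map suc (upTo N) g))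

δ : ℕ → ℕ → ℕ
δ a b with a ℕ.≟ b
... | yes _ = 1
... | no  _ = 0

≡⇒δ≡1 : ∀ {a b} → a ≡ b → δ a b ≡ 1
≡⇒δ≡1 {a} {b} a≡b with a ℕ.≟ b
... | yes _   = refl
... | no  a≢b = contradiction a≡b a≢b

∑-δ≡0 : ∀ {xs} a → All (a ≢_) xs → ∑[ x ∈ xs ] δ x a ≡ 0
∑-δ≡0 a []                = refl
∑-δ≡0 a (_∷_ {x} a≢x a∉xs) with x ℕ.≟ a
... | yes x≡a = contradiction (sym x≡a) a≢x
... | no  _   = ∑-δ≡0 a a∉xs

∑-δ≤1 : ∀ {xs} a → Unique xs → ∑[ x ∈ xs ] δ x a ≤ 1
∑-δ≤1 a []                       = z≤n
∑-δ≤1 a (_∷_ {x} x∉xs xs-unique) with x ℕ.≟ a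
... | yes refl = ≤-reflexive (cong suc (∑-δ≡0 a x∉xs))
... | no  _    = ∑-δ≤1 a xs-unique

module _ {A B : Set} {p} {P : Pred B p} (P? : Decidable P) where

  length-filter-map : ∀ (f : A → B) xs → length (filter P? (map f xs)) ≡ length (filter (P? ∘ f) xs)
  length-filter-map f []       = refl
  length-filter-map f (x ∷ xs) with does (P? (f x))
  ... | true  = cong suc (length-filter-map f xs)
  ... | false = length-filter-map f xs

  length-filter-concatMap : ∀ (f : A → List B) xs →
    length (filter P? (concatMap f xs)) ≡ ∑[ x ∈ xs ] length (filter P? (f x))
  length-filter-concatMap f []       = refl
  length-filter-concatMap f (x ∷ xs) = begin
    length (filter P? (f x ++ concatMap f xs))                ≡⟨ cong length (filter-++ P? (f x) _) ⟩
    length (filter P? (f x) ++ filter P? (concatMap f xs))    ≡⟨ length-++ (filter P? (f x)) ⟩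
    length (filter P? (f x)) + length (filter P? (concatMap f xs))
      ≡⟨ cong (length (filter P? (f x)) +_) (length-filter-concatMap f xs) ⟩
    ∑[ x ∈ x ∷ xs ] length (filter P? (f x))                  ∎
    where open ≡-Reasoning

module _ {A : Set} {p} {P : Pred A p} (P? : Decidable P) where

  ∑-indicator : ∀ xs f N → (∀ {x} → P x → f x ≡ N) → (∀ {x} → ¬ P x → f x ≡ 0) →
    ∑ xs f ≡ length (filter P? xs) * N
  ∑-indicator []       f N on off = refl
  ∑-indicator (x ∷ xs) f N on off with P? x
  ... | yes px = cong₂ _+_ (on px) (∑-indicator xs f N on off)
  ... | no ¬px = trans (cong (_+ ∑ xs f) (off ¬px)) (∑-indicator xs f N on off)

module _ {A : Set} where

  private
    remove : ∀ {x : A} ys → x List.∈ ys → List A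
    remove (_ ∷ ys) (here _)    = ys
    remove (y ∷ ys) (there x∈ys) = y ∷ remove ys x∈ys

    length-remove : ∀ {x : A} ys (x∈ys : x List.∈ ys) → suc (length (remove ys x∈ys)) ≡ length ys
    length-remove (_ ∷ ys) (here _)     = refl
    length-remove (y ∷ ys) (there x∈ys) = cong suc (length-remove ys x∈ys)

    ∈-remove : ∀ {x z : A} ys (x∈ys : x List.∈ ys) → z List.∈ ys → x ≢ z → z List.∈ remove ys x∈ys
    ∈-remove (_ ∷ ys) (here refl)  (here refl)  x≢z = contradiction refl x≢z
    ∈-remove (_ ∷ ys) (here _)     (there z∈ys) x≢z = z∈ys
    ∈-remove (y ∷ ys) (there x∈ys) (here z≡y)   x≢z = here z≡y
    ∈-remove (y ∷ ys) (there x∈ys) (there z∈ys) x≢z = there (∈-remove ys x∈ys z∈ys x≢z)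

  length-mono-⊆-Unique : ∀ {xs ys : List A} → Unique xs → (∀ {x} → x List.∈ xs → x List.∈ ys) → length xs ≤ length ys
  length-mono-⊆-Unique {[]}     _                   _     = z≤n
  length-mono-⊆-Unique {x ∷ xs} {ys} (x∉xs ∷ xs-unique) xs⊆ys =
    subst (suc (length xs) ≤_) (length-remove ys x∈ys)
      (s≤s (length-mono-⊆-Unique xs-unique (λ z∈xs → ∈-remove ys x∈ys (xs⊆ys (there z∈xs)) (All.lookup x∉xs z∈xs))))
    where x∈ys = xs⊆ys (here refl)

∏ : ∀ {m} → (Fin m → ℕ) → ℕ
∏ {zero}  f = 1
∏ {suc m} f = f zero * ∏ (f ∘ suc)

∏-cong : ∀ {m} {f g : Fin m → ℕ} → (∀ i → f i ≡ g i) → ∏ f ≡ ∏ g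
∏-cong {zero}  f≗g = refl
∏-cong {suc m} f≗g = cong₂ _*_ (f≗g zero) (∏-cong (f≗g ∘ suc))

∏-const : ∀ m a → ∏ {m} (λ _ → a) ≡ a ^ m
∏-const zero    a = refl
∏-const (suc m) a = cong (a *_) (∏-const m a)

there⁻¹ : ∀ {m b} {S : Subset m} {i} → suc i ∈ (b ∷ S) → i ∈ S
there⁻¹ (there i∈S) = i∈S

∏-≤-split : ∀ {m} (S : Subset m) {f : Fin m → ℕ} {a b} → (∀ {i} → i ∈ S → f i ≤ a) → (∀ {i} → i ∉ S → f i ≤ b) →
  ∏ f ≤ a ^ ∣ S ∣ * b ^ (m ∸ ∣ S ∣)
∏-≤-split []             f≤a f≤b = ≤-refl
∏-≤-split {suc m} (inside ∷ S) {f} {a} {b} f≤a f≤b = begin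
  f zero * ∏ (f ∘ suc)                   ≤⟨ *-mono-≤ (f≤a here) (∏-≤-split S (λ i∈S → f≤a (there i∈S)) (λ i∉S → f≤b (i∉S ∘ there⁻¹))) ⟩
  a * (a ^ ∣ S ∣ * b ^ (m ∸ ∣ S ∣))      ≡⟨ *-assoc a _ _ ⟨
  a * a ^ ∣ S ∣ * b ^ (m ∸ ∣ S ∣)        ∎
  where open ≤-Reasoning
∏-≤-split {suc m} (outside ∷ S) {f} {a} {b} f≤a f≤b = begin
  f zero * ∏ (f ∘ suc)                   ≤⟨ *-mono-≤ (f≤b λ ()) (∏-≤-split S (λ i∈S → f≤a (there i∈S)) (λ i∉S → f≤b (i∉S ∘ there⁻¹))) ⟩
  b * (a ^ ∣ S ∣ * b ^ (m ∸ ∣ S ∣))      ≡⟨ x*[y*z]≡y*[x*z] b (a ^ ∣ S ∣) _ ⟩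
  a ^ ∣ S ∣ * (b * b ^ (m ∸ ∣ S ∣))      ≡⟨ cong (λ e → a ^ ∣ S ∣ * b ^ e) (+-∸-assoc 1 (∣p∣≤n S)) ⟨
  a ^ ∣ S ∣ * b ^ (suc m ∸ ∣ S ∣)        ∎
  where open ≤-Reasoning

-- Counting configurations

allSubsets-complete : ∀ {n} (T : Subset n) → T List.∈ allSubsets n
allSubsets-complete []                = here refl
allSubsets-complete (outside ∷ T)     = ∈-++⁺ˡ (∈-map⁺ (outside ∷_) (allSubsets-complete T))
allSubsets-complete {suc n} (inside ∷ T) =
  ∈-++⁺ʳ (map (outside ∷_) (allSubsets n)) (∈-map⁺ (inside ∷_) (allSubsets-complete T))

allVecs-complete : ∀ {A : Set} {xs : List A} → (∀ a → a List.∈ xs) → ∀ {m} (c : Vec A m) → c List.∈ allVecs xs m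
allVecs-complete xs-complete []      = here refl
allVecs-complete xs-complete (a ∷ c) =
  ∈-concatMap⁺ _ (lose (xs-complete a) (∈-map⁺ (a ∷_) (allVecs-complete xs-complete c)))

allConfigs-complete : ∀ {n} (c : Config n) → c List.∈ allConfigs n
allConfigs-complete = allVecs-complete allSubsets-complete

Choice : ∀ {n} → ℕ → Subset n → Subset n → Set
Choice k U T = T ⊆ U × ∣ T ∣ ≡ k

choice? : ∀ {n} k (U : Subset n) → Decidable (Choice k U)
choice? k U T = (T ⊆? U) ×-dec (∣ T ∣ ℕ.≟ k)

length-filter-allSubsets-suc : ∀ {n p} {P : Pred (Subset (suc n)) p} (P? : Decidable P) →
  length (filter P? (allSubsets (suc n)))
    ≡ length (filter (P? ∘ (outside ∷_)) (allSubsets n)) + length (filter (P? ∘ (inside ∷_)) (allSubsets n))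
length-filter-allSubsets-suc {n} P? = begin
  length (filter P? (map (outside ∷_) (allSubsets n) ++ map (inside ∷_) (allSubsets n)))
    ≡⟨ cong length (filter-++ P? (map (outside ∷_) (allSubsets n)) _) ⟩
  length (filter P? (map (outside ∷_) (allSubsets n)) ++ filter P? (map (inside ∷_) (allSubsets n)))
    ≡⟨ length-++ (filter P? (map (outside ∷_) (allSubsets n))) ⟩
  length (filter P? (map (outside ∷_) (allSubsets n))) + length (filter P? (map (inside ∷_) (allSubsets n)))
    ≡⟨ cong₂ _+_ (length-filter-map P? (outside ∷_) (allSubsets n)) (length-filter-map P? (inside ∷_) (allSubsets n)) ⟩
  length (filter (P? ∘ (outside ∷_)) (allSubsets n)) + length (filter (P? ∘ (inside ∷_)) (allSubsets n)) ∎
  where open ≡-Reasoning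

length-filter-choice : ∀ {n} k (U : Subset n) → length (filter (choice? k U) (allSubsets n)) ≡ ∣ U ∣ C k
length-filter-choice {zero}  zero    [] = refl
length-filter-choice {zero}  (suc k) [] = refl
length-filter-choice {suc n} k (b ∷ U) = begin
  length (filter (choice? k (b ∷ U)) (allSubsets (suc n)))
    ≡⟨ length-filter-allSubsets-suc (choice? k (b ∷ U)) ⟩
  length (filter (choice? k (b ∷ U) ∘ (outside ∷_)) (allSubsets n)) + count-inside b k
    ≡⟨ cong (_+ count-inside b k) (trans (cong length (filter-≐ _ (choice? k U) (drop-outside , add-outside) (allSubsets n)))
                                         (length-filter-choice k U)) ⟩
  ∣ U ∣ C k + count-inside b k
    ≡⟨ with-inside b k ⟩
  ∣ b ∷ U ∣ C k ∎
  where
  open ≡-Reasoning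
  count-inside : ∀ b k → ℕ
  count-inside b k = length (filter (choice? k (b ∷ U) ∘ (inside ∷_)) (allSubsets n))
  drop-outside : ∀ {b k T} → Choice k (b ∷ U) (outside ∷ T) → Choice k U T
  drop-outside (T⊆U , ∣T∣≡k) = (λ x∈T → there⁻¹ (T⊆U (there x∈T))) , ∣T∣≡k
  add-outside : ∀ {b k T} → Choice k U T → Choice k (b ∷ U) (outside ∷ T)
  add-outside (T⊆U , ∣T∣≡k) = (λ { (there x∈T) → there (T⊆U x∈T) }) , ∣T∣≡k
  none : ∀ {b k} → (∀ {T} → ¬ Choice k (b ∷ U) (inside ∷ T)) → count-inside b k ≡ 0
  none ¬choice = cong length (filter-none _ (All.universal (λ _ → ¬choice) (allSubsets n)))
  with-inside : ∀ b k → ∣ U ∣ C k + count-inside b k ≡ ∣ b ∷ U ∣ C k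
  with-inside outside k = trans (cong (∣ U ∣ C k +_) (none λ (T⊆U , _) → case T⊆U here of λ ())) (+-identityʳ _)
  with-inside inside zero = cong suc (none λ ())
  with-inside inside (suc k) = begin
    ∣ U ∣ C suc k + count-inside inside (suc k)
      ≡⟨ cong (∣ U ∣ C suc k +_) (trans (cong length (filter-≐ _ (choice? k U) (drop-inside , add-inside) (allSubsets n)))
                                       (length-filter-choice k U)) ⟩
    ∣ U ∣ C suc k + ∣ U ∣ C k   ≡⟨ +-comm (∣ U ∣ C suc k) _ ⟩
    ∣ U ∣ C k + ∣ U ∣ C suc k   ≡⟨ nCk+nC[k+1]≡[n+1]C[k+1] ∣ U ∣ k ⟩
    suc ∣ U ∣ C suc k           ∎
    where
    drop-inside : ∀ {T} → Choice (suc k) (inside ∷ U) (inside ∷ T) → Choice k U T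
    drop-inside (T⊆U , ∣T∣≡k) = (λ x∈T → there⁻¹ (T⊆U (there x∈T))) , suc-injective ∣T∣≡k
    add-inside : ∀ {T} → Choice k U T → Choice (suc k) (inside ∷ U) (inside ∷ T)
    add-inside (T⊆U , ∣T∣≡k) = (λ { here → here ; (there x∈T) → there (T⊆U x∈T) }) , cong suc ∣T∣≡k

length-filter-allVecs : ∀ {A : Set} (xs : List A) m {Q : Fin m → A → Set} (Q? : ∀ i → Decidable (Q i))
  {ℓ} {P : Pred (Vec A m) ℓ} (P? : Decidable P) →
  (∀ {c} → P c → ∀ i → Q i (lookup c i)) → (∀ {c} → (∀ i → Q i (lookup c i)) → P c) →
  length (filter P? (allVecs xs m)) ≡ ∏ (λ i → length (filter (Q? i) xs))
length-filter-allVecs xs zero    Q? P? P⇒Q Q⇒P = cong length (filter-accept P? (Q⇒P λ ()))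
length-filter-allVecs xs (suc m) {Q} Q? P? P⇒Q Q⇒P = begin
  length (filter P? (concatMap (λ x → map (x ∷_) (allVecs xs m)) xs))
    ≡⟨ length-filter-concatMap P? _ xs ⟩
  ∑[ x ∈ xs ] length (filter P? (map (x ∷_) (allVecs xs m)))
    ≡⟨ ∑-indicator (Q? zero) xs _ _ with-head without-head ⟩
  length (filter (Q? zero) xs) * ∏ (λ i → length (filter (Q? (suc i)) xs)) ∎
  where
  open ≡-Reasoning
  with-head : ∀ {x} → Q zero x → length (filter P? (map (x ∷_) (allVecs xs m))) ≡ ∏ (λ i → length (filter (Q? (suc i)) xs))
  with-head {x} q = trans (length-filter-map P? (x ∷_) (allVecs xs m))
    (length-filter-allVecs xs m (Q? ∘ suc) (P? ∘ (x ∷_)) (λ p i → P⇒Q p (suc i)) (λ qs → Q⇒P λ { zero → q ; (suc i) → qs i }))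
  without-head : ∀ {x} → ¬ Q zero x → length (filter P? (map (x ∷_) (allVecs xs m))) ≡ 0
  without-head {x} ¬q = trans (length-filter-map P? (x ∷_) (allVecs xs m))
    (cong length (filter-none (P? ∘ (x ∷_)) (All.universal (λ _ p → ¬q (P⇒Q p zero)) (allVecs xs m))))

ChoosesWithin : ∀ {n} → ℕ → (Fin n → Subset n) → Config n → Set
ChoosesWithin k D c = ∀ v → Choice k (D v) (lookup c v)

choosesWithin? : ∀ {n} k (D : Fin n → Subset n) → Decidable (ChoosesWithin k D)
choosesWithin? k D c = all? (λ v → choice? k (D v) (lookup c v))

length-filter-choosesWithin : ∀ {n} k (D : Fin n → Subset n) →
  length (filter (choosesWithin? k D) (allConfigs n)) ≡ ∏ (λ v → ∣ D v ∣ C k)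
length-filter-choosesWithin {n} k D = trans
  (length-filter-allVecs (allSubsets n) n (λ v → choice? k (D v)) (choosesWithin? k D) id id)
  (∏-cong (λ v → length-filter-choice k (D v)))

∉⇔⊆∁⁅⁆ : ∀ {n} {v : Fin n} {T} → v ∉ T ⇔ T ⊆ ∁ ⁅ v ⁆
∉⇔⊆∁⁅⁆ {v = v} = mk⇔ (λ v∉T {w} w∈T → x∉p⇒x∈∁p (x≢y⇒x∉⁅y⁆ λ { refl → v∉T w∈T }))
                     (λ T⊆∁v v∈T → x∈p⇒x∉∁p (x∈⁅x⁆ v) (T⊆∁v v∈T))

length-filter-valid : ∀ n k → length (filter (valid? k) (allConfigs n)) ≡ ((n ∸ 1) C k) ^ n
length-filter-valid n k = begin
  length (filter (valid? k) (allConfigs n))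
    ≡⟨ cong length (filter-≐ (valid? k) (choosesWithin? k (∁ ∘ ⁅_⁆)) ((λ {c} → valid⇒ {c}) , (λ {c} → ⇒valid {c})) (allConfigs n)) ⟩
  length (filter (choosesWithin? k (∁ ∘ ⁅_⁆)) (allConfigs n))
    ≡⟨ length-filter-choosesWithin {n} k (∁ ∘ ⁅_⁆) ⟩
  ∏ {n} (λ v → ∣ ∁ ⁅ v ⁆ ∣ C k)
    ≡⟨ ∏-cong (λ v → cong (_C k) (trans (∣∁p∣≡n∸∣p∣ ⁅ v ⁆) (cong (n ∸_) (∣⁅x⁆∣≡1 v)))) ⟩
  ∏ {n} (λ _ → (n ∸ 1) C k)
    ≡⟨ ∏-const n _ ⟩
  ((n ∸ 1) C k) ^ n ∎
  where
  open ≡-Reasoning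
  valid⇒ : ∀ {c} → Valid k c → ChoosesWithin k (∁ ∘ ⁅_⁆) c
  valid⇒ valid v = Equivalence.to ∉⇔⊆∁⁅⁆ (proj₁ (valid v)) , proj₂ (valid v)
  ⇒valid : ∀ {c} → ChoosesWithin k (∁ ∘ ⁅_⁆) c → Valid k c
  ⇒valid choice v = Equivalence.from ∉⇔⊆∁⁅⁆ (proj₁ (choice v)) , proj₂ (choice v)

∑-allSubsets-suc : ∀ n (f : Subset (suc n) → ℕ) → ∑ (allSubsets (suc n)) f ≡ ∑[ T ∈ allSubsets n ] f (outside ∷ T) + ∑[ T ∈ allSubsets n ] f (inside ∷ T)
∑-allSubsets-suc n f = trans (∑-++ (map (outside ∷_) (allSubsets n)) _ f)
  (cong₂ _+_ (∑-map (outside ∷_) (allSubsets n) f) (∑-map (inside ∷_) (allSubsets n) f))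

∑-allSubsets-bySize : ∀ n {N} → n < N → ∀ (f : ℕ → ℕ) → ∑[ S ∈ allSubsets n ] f ∣ S ∣ ≡ ∑[ s ∈ upTo N ] ((n C s) * f s)
∑-allSubsets-bySize zero    {suc N} _           f = sym (trans (∑-upTo-suc N _)
  (cong₂ _+_ (*-identityˡ (f 0)) (trans (∑-const (upTo N) 0) (*-zeroʳ (length (upTo N))))))
∑-allSubsets-bySize (suc n) {suc N} (s≤s n<N) f = begin
  ∑[ S ∈ allSubsets (suc n) ] f ∣ S ∣
    ≡⟨ ∑-allSubsets-suc n (f ∘ ∣_∣) ⟩
  ∑[ T ∈ allSubsets n ] f ∣ T ∣ + ∑[ T ∈ allSubsets n ] f (suc ∣ T ∣)
    ≡⟨ cong₂ _+_ (∑-allSubsets-bySize n (m<n⇒m<1+n n<N) f) (∑-allSubsets-bySize n n<N (f ∘ suc)) ⟩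
  ∑[ s ∈ upTo (suc N) ] ((n C s) * f s) + ∑[ s ∈ upTo N ] ((n C s) * f (suc s))
    ≡⟨ cong (_+ ∑[ s ∈ upTo N ] ((n C s) * f (suc s))) (∑-upTo-suc N _) ⟩
  (1 * f 0 + ∑[ s ∈ upTo N ] ((n C suc s) * f (suc s))) + ∑[ s ∈ upTo N ] ((n C s) * f (suc s))
    ≡⟨ +-assoc (1 * f 0) _ _ ⟩
  1 * f 0 + (∑[ s ∈ upTo N ] ((n C suc s) * f (suc s)) + ∑[ s ∈ upTo N ] ((n C s) * f (suc s)))
    ≡⟨ cong (1 * f 0 +_) (sym (∑-+ (upTo N) _ _)) ⟩
  1 * f 0 + ∑[ s ∈ upTo N ] ((n C suc s) * f (suc s) + (n C s) * f (suc s))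
    ≡⟨ cong (1 * f 0 +_) (∑-cong (upTo N) pascal) ⟩
  1 * f 0 + ∑[ s ∈ upTo N ] ((suc n C suc s) * f (suc s))
    ≡⟨ ∑-upTo-suc N _ ⟨
  ∑[ s ∈ upTo (suc N) ] ((suc n C s) * f s) ∎
  where
  open ≡-Reasoning
  pascal : ∀ s → (n C suc s) * f (suc s) + (n C s) * f (suc s) ≡ (suc n C suc s) * f (suc s)
  pascal s = trans (sym (*-distribʳ-+ (f (suc s)) (n C suc s) _))
    (cong (_* f (suc s)) (trans (+-comm (n C suc s) _) (nCk+nC[k+1]≡[n+1]C[k+1] n s)))

∑-allSubsets-binomial : ∀ n a b → ∑[ S ∈ allSubsets n ] (a ^ ∣ S ∣ * b ^ (n ∸ ∣ S ∣)) ≡ (a + b) ^ n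
∑-allSubsets-binomial zero    a b = refl
∑-allSubsets-binomial (suc n) a b = begin
  ∑[ S ∈ allSubsets (suc n) ] (a ^ ∣ S ∣ * b ^ (suc n ∸ ∣ S ∣))
    ≡⟨ ∑-allSubsets-suc n _ ⟩
  ∑[ T ∈ allSubsets n ] (a ^ ∣ T ∣ * b ^ (suc n ∸ ∣ T ∣)) + ∑[ T ∈ allSubsets n ] (a * a ^ ∣ T ∣ * b ^ (n ∸ ∣ T ∣))
    ≡⟨ cong₂ _+_ (∑-cong (allSubsets n) pull-b) (∑-cong (allSubsets n) (λ T → *-assoc a (a ^ ∣ T ∣) _)) ⟩
  ∑[ T ∈ allSubsets n ] (b * term T) + ∑[ T ∈ allSubsets n ] (a * term T)
    ≡⟨ cong₂ _+_ (*-distribˡ-∑ b (allSubsets n) term) (*-distribˡ-∑ a (allSubsets n) term) ⟨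
  b * ∑ (allSubsets n) term + a * ∑ (allSubsets n) term
    ≡⟨ cong (λ x → b * x + a * x) (∑-allSubsets-binomial n a b) ⟩
  b * (a + b) ^ n + a * (a + b) ^ n
    ≡⟨ trans (*-distribʳ-+ ((a + b) ^ n) a b) (+-comm (a * (a + b) ^ n) _) ⟨
  (a + b) ^ suc n ∎
  where
  open ≡-Reasoning
  term : Subset n → ℕ
  term T = a ^ ∣ T ∣ * b ^ (n ∸ ∣ T ∣)
  pull-b : ∀ T → a ^ ∣ T ∣ * b ^ (suc n ∸ ∣ T ∣) ≡ b * term T
  pull-b T = trans (cong (λ e → a ^ ∣ T ∣ * b ^ e) (+-∸-assoc 1 (∣p∣≤n T))) (x*[y*z]≡y*[x*z] (a ^ ∣ T ∣) b _)

nCs*a^s*b^[n∸s]≤[a+b]^n : ∀ {n s} a b → s ≤ n → (n C s) * (a ^ s * b ^ (n ∸ s)) ≤ (a + b) ^ n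
nCs*a^s*b^[n∸s]≤[a+b]^n {n} {s} a b s≤n = begin
  (n C s) * (a ^ s * b ^ (n ∸ s))                             ≤⟨ term≤∑ (λ r → (n C r) * (a ^ r * b ^ (n ∸ r))) (∈-upTo⁺ (s≤s s≤n)) ⟩
  ∑[ r ∈ upTo (suc n) ] ((n C r) * (a ^ r * b ^ (n ∸ r)))      ≡⟨ ∑-allSubsets-bySize n ≤-refl _ ⟨
  ∑[ S ∈ allSubsets n ] (a ^ ∣ S ∣ * b ^ (n ∸ ∣ S ∣))          ≡⟨ ∑-allSubsets-binomial n a b ⟩
  (a + b) ^ n                                                 ∎
  where open ≤-Reasoning

-- Estimates for binomial coefficients

nCk≤[1+n]Ck : ∀ n k → n C k ≤ suc n C k
nCk≤[1+n]Ck n       zero    = ≤-refl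
nCk≤[1+n]Ck zero    (suc k) = z≤n
nCk≤[1+n]Ck (suc n) (suc k) = ≤-trans (m≤n+m _ (suc n C k)) (≤-reflexive (nCk+nC[k+1]≡[n+1]C[k+1] (suc n) k))

C-monoˡ-≤ : ∀ k {a b} → a ≤ b → a C k ≤ b C k
C-monoˡ-≤ k {b = zero}  z≤n = ≤-refl
C-monoˡ-≤ k {b = suc b} a≤1+b with m≤n⇒m<n∨m≡n a≤1+b
... | inj₁ (s≤s a≤b) = ≤-trans (C-monoˡ-≤ k a≤b) (nCk≤[1+n]Ck b k)
... | inj₂ refl      = ≤-refl

nCk≤2^n : ∀ n k → n C k ≤ 2 ^ n
nCk≤2^n n       zero    = m^n>0 2 n
nCk≤2^n zero    (suc k) = z≤n
nCk≤2^n (suc n) (suc k) = begin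
  suc n C suc k          ≡⟨ nCk+nC[k+1]≡[n+1]C[k+1] n k ⟨
  n C k + n C suc k      ≤⟨ +-mono-≤ (nCk≤2^n n k) (nCk≤2^n n (suc k)) ⟩
  2 ^ n + 2 ^ n          ≡⟨ cong (2 ^ n +_) (+-identityʳ (2 ^ n)) ⟨
  2 ^ suc n              ∎
  where open ≤-Reasoning

nCk*k!≡nP′k : ∀ {n k} → k ≤ n → (n C k) * k ! ≡ n P′ k
nCk*k!≡nP′k {n} {k} k≤n = trans (cong (_* k !) nCk≡nP′k/k!) (m/n*n≡m {{k !≢0}} (k!∣nP′k k≤n))
  where
  nCk≡nP′k/k! : n C k ≡ _/_ (n P′ k) (k !) {{k !≢0}}
  nCk≡nP′k/k! = trans (nCk≡nPk/k! k≤n)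
    (cong (λ m → _/_ m (k !) {{k !≢0}}) (trans (nPk≡n!/[n∸k]! k≤n) (sym (nP′k≡n!/[n∸k]! k≤n))))

[a∸i]*[b+c]≤[a+c]*[b∸i] : ∀ {a b} i c → a ≤ b → (a ∸ i) * (b + c) ≤ (a + c) * (b ∸ i)
[a∸i]*[b+c]≤[a+c]*[b∸i] {a} i c a≤b with i ≤? a
... | no i≰a = ≤-trans (≤-reflexive (cong (_* (b + c)) (m≤n⇒m∸n≡0 (≰⇒≥ i≰a)))) z≤n
  where b = _
... | yes i≤a with m≤n⇒∃[o]m+o≡n i≤a | m≤n⇒∃[o]m+o≡n a≤b
...   | x , refl | y , refl = begin
  (i + x ∸ i) * (i + x + y + c)          ≡⟨ cong (_* (i + x + y + c)) (m+n∸m≡n i x) ⟩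
  x * (i + x + y + c)                    ≤⟨ m≤m+n _ ((i + c) * y) ⟩
  x * (i + x + y + c) + (i + c) * y      ≡⟨ expand i x y c ⟩
  (i + x + c) * (x + y)                  ≡⟨ cong ((i + x + c) *_) (m+n∸m≡n i (x + y)) ⟨
  (i + x + c) * (i + (x + y) ∸ i)        ≡⟨ cong (λ z → (i + x + c) * (z ∸ i)) (+-assoc i x y) ⟨
  (i + x + c) * (i + x + y ∸ i)          ∎
  where
  open ≤-Reasoning
  expand : ∀ i x y c → x * (i + x + y + c) + (i + c) * y ≡ (i + x + c) * (x + y)
  expand = solve-∀

P′-ratio : ∀ {a b} k c → a ≤ b → (a P′ k) * (b + c) ^ k ≤ (a + c) ^ k * (b P′ k)
P′-ratio         zero    c a≤b = ≤-refl
P′-ratio {a} {b} (suc k) c a≤b = begin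
  (a ∸ k) * (a P′ k) * ((b + c) * (b + c) ^ k)        ≡⟨ *-interchange (a ∸ k) _ (b + c) _ ⟩
  ((a ∸ k) * (b + c)) * ((a P′ k) * (b + c) ^ k)      ≤⟨ *-mono-≤ ([a∸i]*[b+c]≤[a+c]*[b∸i] k c a≤b) (P′-ratio k c a≤b) ⟩
  ((a + c) * (b ∸ k)) * ((a + c) ^ k * (b P′ k))      ≡⟨ *-interchange (a + c) _ _ _ ⟩
  (a + c) * (a + c) ^ k * ((b ∸ k) * (b P′ k))        ∎
  where open ≤-Reasoning

C-ratio : ∀ {a b} k c → a ≤ b → (a C k) * (b + c) ^ k ≤ (a + c) ^ k * (b C k)
C-ratio {a} {b} k c a≤b with k ≤? a
... | no k≰a = ≤-trans (≤-reflexive (cong (_* (b + c) ^ k) (k>n⇒nCk≡0 (≰⇒> k≰a)))) z≤n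
... | yes k≤a = *-cancelʳ-≤ _ _ (k !) {{k !≢0}} (begin
  (a C k) * (b + c) ^ k * k !       ≡⟨ x*y*z≡x*z*y (a C k) _ _ ⟩
  (a C k) * k ! * (b + c) ^ k       ≡⟨ cong (_* (b + c) ^ k) (nCk*k!≡nP′k k≤a) ⟩
  (a P′ k) * (b + c) ^ k            ≤⟨ P′-ratio k c a≤b ⟩
  (a + c) ^ k * (b P′ k)            ≡⟨ cong ((a + c) ^ k *_) (nCk*k!≡nP′k (≤-trans k≤a a≤b)) ⟨
  (a + c) ^ k * ((b C k) * k !)     ≡⟨ *-assoc ((a + c) ^ k) _ _ ⟨
  (a + c) ^ k * (b C k) * k !       ∎)
  where open ≤-Reasoning

m^p≤p^p*2^m : ∀ {p m} → p ≤ m → m ^ p ≤ p ^ p * 2 ^ m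
m^p≤p^p*2^m {p} {m} p≤m = begin
  m ^ p                           ≡⟨ *-identityˡ (m ^ p) ⟨
  1 * m ^ p                       ≡⟨ cong₂ (λ x y → x * y ^ p) (nCn≡1 p) (+-identityʳ m) ⟨
  (p C p) * (m + 0) ^ p           ≤⟨ C-ratio p 0 p≤m ⟩
  (p + 0) ^ p * (m C p)           ≤⟨ *-mono-≤ (≤-reflexive (cong (_^ p) (+-identityʳ p))) (nCk≤2^n m p) ⟩
  p ^ p * 2 ^ m                   ∎
  where open ≤-Reasoning

^-distribʳ-* : ∀ m n k → (m * n) ^ k ≡ m ^ k * n ^ k
^-distribʳ-* m n zero    = refl
^-distribʳ-* m n (suc k) = trans (cong (m * n *_) (^-distribʳ-* m n k)) (*-interchange m n _ _)

s^s*n^p≤p^p*2^p*n^s : ∀ {p s n} → p ≤ s → 2 * s ≤ n → s ^ s * n ^ p ≤ p ^ p * 2 ^ p * n ^ s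
s^s*n^p≤p^p*2^p*n^s {p} {s} {n} p≤s 2s≤n with m≤n⇒∃[o]m+o≡n p≤s
... | r , refl = *-cancelˡ-≤ (2 ^ r) {{m^n≢0 2 r}} (begin
  2 ^ r * (s ^ (p + r) * n ^ p)         ≡⟨ cong (λ x → 2 ^ r * (x * n ^ p)) (^-distribˡ-+-* s p r) ⟩
  2 ^ r * (s ^ p * s ^ r * n ^ p)       ≡⟨ regroup (2 ^ r) (s ^ p) (s ^ r) (n ^ p) ⟩
  s ^ p * (2 ^ r * s ^ r) * n ^ p       ≡⟨ cong (λ x → s ^ p * x * n ^ p) (^-distribʳ-* 2 s r) ⟨
  s ^ p * (2 * s) ^ r * n ^ p           ≤⟨ *-monoˡ-≤ (n ^ p) (*-monoʳ-≤ (s ^ p) (^-monoˡ-≤ r 2s≤n)) ⟩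
  s ^ p * n ^ r * n ^ p                 ≡⟨ trans (x*y*z≡x*z*y (s ^ p) _ _) (*-assoc (s ^ p) _ _) ⟩
  s ^ p * (n ^ p * n ^ r)               ≡⟨ cong (s ^ p *_) (^-distribˡ-+-* n p r) ⟨
  s ^ p * n ^ (p + r)                   ≤⟨ *-monoˡ-≤ (n ^ (p + r)) (m^p≤p^p*2^m p≤s) ⟩
  p ^ p * 2 ^ (p + r) * n ^ (p + r)     ≡⟨ cong (λ x → p ^ p * x * n ^ (p + r)) (^-distribˡ-+-* 2 p r) ⟩
  p ^ p * (2 ^ p * 2 ^ r) * n ^ (p + r) ≡⟨ regroup′ (p ^ p) (2 ^ p) (2 ^ r) (n ^ (p + r)) ⟩
  2 ^ r * (p ^ p * 2 ^ p * n ^ (p + r)) ∎)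
  where
  open ≤-Reasoning
  regroup : ∀ a b c d → a * (b * c * d) ≡ b * (a * c) * d
  regroup = solve-∀
  regroup′ : ∀ a b c d → a * (b * c) * d ≡ c * (a * b * d)
  regroup′ = solve-∀

private
  entropy-bound-≤ : ∀ {p s t} → p ≤ s → s ≤ t → s ^ s * t ^ t * (s + t) ^ p ≤ p ^ p * 2 ^ p * (s + t) ^ (s + t)
  entropy-bound-≤ {p} {s} {t} p≤s s≤t = begin
    s ^ s * t ^ t * n ^ p           ≤⟨ *-monoˡ-≤ (n ^ p) (*-monoʳ-≤ (s ^ s) (^-monoˡ-≤ t (m≤n+m t s))) ⟩
    s ^ s * n ^ t * n ^ p           ≡⟨ x*y*z≡x*z*y (s ^ s) _ _ ⟩
    s ^ s * n ^ p * n ^ t           ≤⟨ *-monoˡ-≤ (n ^ t) (s^s*n^p≤p^p*2^p*n^s p≤s 2s≤n) ⟩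
    p ^ p * 2 ^ p * n ^ s * n ^ t   ≡⟨ *-assoc (p ^ p * 2 ^ p) _ _ ⟩
    p ^ p * 2 ^ p * (n ^ s * n ^ t) ≡⟨ cong (p ^ p * 2 ^ p *_) (^-distribˡ-+-* n s t) ⟨
    p ^ p * 2 ^ p * n ^ (s + t)     ∎
    where
    open ≤-Reasoning
    n = s + t
    2s≤n : 2 * s ≤ s + t
    2s≤n = ≤-trans (≤-reflexive (cong (s +_) (+-identityʳ s))) (+-monoʳ-≤ s s≤t)

s^s*t^t*[s+t]^p≤p^p*2^p*[s+t]^[s+t] : ∀ {p s t} → p ≤ s → p ≤ t →
  s ^ s * t ^ t * (s + t) ^ p ≤ p ^ p * 2 ^ p * (s + t) ^ (s + t)
s^s*t^t*[s+t]^p≤p^p*2^p*[s+t]^[s+t] {p} {s} {t} p≤s p≤t with s ≤? t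
... | yes s≤t = entropy-bound-≤ p≤s s≤t
... | no  s≰t = subst₂ _≤_
  (cong₂ _*_ (*-comm (t ^ t) (s ^ s)) (cong (_^ p) (+-comm t s)))
  (cong (λ n → p ^ p * 2 ^ p * n ^ n) (+-comm t s))
  (entropy-bound-≤ p≤t (<⇒≤ (≰⇒> s≰t)))

-- Connected components

subsetOf : ∀ {n ℓ} {P : Pred (Fin n) ℓ} → Decidable P → Subset n
subsetOf P? = tabulate (λ x → does (P? x))

module _ {n ℓ} {P : Pred (Fin n) ℓ} (P? : Decidable P) where

  ∈-subsetOf⁺ : ∀ {x} → P x → x ∈ subsetOf P?
  ∈-subsetOf⁺ {x} px with P? x in eq
  ... | yes _  = lookup⇒[]= x _ (trans (lookup∘tabulate _ x) (cong does eq))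
  ... | no ¬px = contradiction px ¬px

  ∈-subsetOf⁻ : ∀ {x} → x ∈ subsetOf P? → P x
  ∈-subsetOf⁻ {x} x∈P with P? x | trans (sym (lookup∘tabulate (λ x → does (P? x)) x)) ([]=⇒lookup x∈P)
  ... | yes px | _ = px
  ... | no  _  | ()

module _ {n} {c : Config n} where

  adj-sym : ∀ {u w} → Adj c u w → Adj c w u
  adj-sym (inj₁ w∈cu) = inj₂ w∈cu
  adj-sym (inj₂ u∈cw) = inj₁ u∈cw

  reach-snoc : ∀ {a u w} → Reach c a u → Adj c u w → Reach c a w
  reach-snoc here           u~w = step u~w here
  reach-snoc (step a~v v⇝u) u~w = step a~v (reach-snoc v⇝u u~w)

  reach-trans : ∀ {a u w} → Reach c a u → Reach c u w → Reach c a w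
  reach-trans here           u⇝w = u⇝w
  reach-trans (step a~v v⇝u) u⇝w = step a~v (reach-trans v⇝u u⇝w)

  reach-sym : ∀ {u w} → Reach c u w → Reach c w u
  reach-sym here           = here
  reach-sym (step u~v v⇝w) = reach-snoc (reach-sym v⇝w) (adj-sym u~v)

Closed : ∀ {n} → Config n → Subset n → Set
Closed c R = ∀ {u w} → u ∈ R → Adj c u w → w ∈ R

module Closure {n} (c : Config n) where

  adj? : ∀ u w → Dec (Adj c u w)
  adj? u w = (w ∈? lookup c u) ⊎-dec (u ∈? lookup c w)

  WithinOneStep : Subset n → Fin n → Set
  WithinOneStep R w = ∃[ u ] (u ∈ R × (u ≡ w ⊎ Adj c u w))

  withinOneStep? : ∀ R → Decidable (WithinOneStep R)
  withinOneStep? R w = any? (λ u → (u ∈? R) ×-dec ((u ≟ w) ⊎-dec adj? u w))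

  expand : Subset n → Subset n
  expand R = subsetOf (withinOneStep? R)

  ⊆-expand : ∀ R → R ⊆ expand R
  ⊆-expand R {w} w∈R = ∈-subsetOf⁺ (withinOneStep? R) (w , w∈R , inj₁ refl)

  anyNew? : ∀ R → Dec (∃[ w ] (w ∈ expand R × w ∉ R))
  anyNew? R = any? (λ w → (w ∈? expand R) ×-dec ¬? (w ∈? R))

  -- Iterates expand until a round adds no vertex; each other round adds one, so n rounds suffice.
  closure : ℕ → Subset n → Subset n
  closure zero    R = R
  closure (suc f) R with anyNew? R
  ... | yes _ = closure f (expand R)
  ... | no  _ = R

  ⊆-closure : ∀ f R → R ⊆ closure f R
  ⊆-closure zero    R w∈R = w∈R
  ⊆-closure (suc f) R w∈R with anyNew? R
  ... | yes _ = ⊆-closure f (expand R) (⊆-expand R w∈R)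
  ... | no  _ = w∈R

  closure-reach : ∀ {a} f R → (∀ {w} → w ∈ R → Reach c a w) → ∀ {w} → w ∈ closure f R → Reach c a w
  closure-reach zero    R reach = reach
  closure-reach (suc f) R reach with anyNew? R
  ... | yes _ = closure-reach f (expand R) expand-reach
    where
    expand-reach : ∀ {w} → w ∈ expand R → Reach c _ w
    expand-reach w∈ with ∈-subsetOf⁻ (withinOneStep? R) w∈
    ... | u , u∈R , inj₁ refl = reach u∈R
    ... | u , u∈R , inj₂ u~w  = reach-snoc (reach u∈R) u~w
  ... | no  _ = reach

  closure-closed : ∀ f R → n ≤ ∣ R ∣ + f → Closed c (closure f R)
  closure-closed zero R n≤∣R∣ {w = w} _ _ =
    subst (w ∈_) (sym (∣p∣≡n⇒p≡⊤ (≤-antisym (∣p∣≤n R) (subst (n ≤_) (+-identityʳ _) n≤∣R∣)))) ∈⊤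
  closure-closed (suc f) R n≤∣R∣+f+1 with anyNew? R
  ... | yes (w , w∈expand , w∉R) = closure-closed f (expand R) (≤-trans n≤∣R∣+f+1 (≤-trans (≤-reflexive (+-suc ∣ R ∣ f))
        (+-monoˡ-≤ f (p⊂q⇒∣p∣<∣q∣ (⊆-expand R , w , w∈expand , w∉R)))))
  ... | no  nothing-new = case-new
    where
    case-new : ∀ {u w} → u ∈ R → Adj c u w → w ∈ R
    case-new {u} {w} u∈R u~w with w ∈? R
    ... | yes w∈R = w∈R
    ... | no  w∉R = contradiction (w , ∈-subsetOf⁺ (withinOneStep? R) (u , u∈R , inj₂ u~w) , w∉R) nothing-new

  component : Fin n → Subset n
  component a = closure n ⁅ a ⁆

  component-closed : ∀ a → Closed c (component a)
  component-closed a = closure-closed n ⁅ a ⁆ (m≤n+m n _)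

  component-reach : ∀ a {w} → w ∈ component a → Reach c a w
  component-reach a = closure-reach n ⁅ a ⁆ λ w∈⁅a⁆ → subst (Reach c a) (sym (x∈⁅y⁆⇒x≡y a w∈⁅a⁆)) here

open Closure using (component; ⊆-closure; component-closed; component-reach)

Proper : ℕ → ℕ → Set
Proper n s = 0 < s × s < n

proper? : ∀ n → Decidable (Proper n)
proper? n s = (1 ≤? s) ×-dec (suc s ≤? n)

disconnected⇒closedProperSubset : ∀ {n} (c : Config n) → ¬ Connected c →
  ∃[ S ] (Proper n ∣ S ∣ × Closed c S)
disconnected⇒closedProperSubset {zero}  c disconnected = contradiction (λ ()) disconnected
disconnected⇒closedProperSubset {suc m} c disconnected =
  S , (nonempty , ≤∧≢⇒< (∣p∣≤n S) ≠full) , component-closed c zero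
  where
  S = component c zero
  nonempty : 1 ≤ ∣ S ∣
  nonempty = subst (_≤ ∣ S ∣) (∣⁅x⁆∣≡1 (zero {m})) (p⊆q⇒∣p∣≤∣q∣ (⊆-closure c (suc m) ⁅ zero ⁆))
  ≠full : ∣ S ∣ ≢ suc m
  ≠full ∣S∣≡n = disconnected λ u v →
    reach-trans (reach-sym (component-reach c zero (∈S u))) (component-reach c zero (∈S v))
    where
    ∈S : ∀ x → x ∈ S
    ∈S x = subst (x ∈_) (sym (∣p∣≡n⇒p≡⊤ ∣S∣≡n)) ∈⊤

-- Disconnected configurations

m<n⇒m≤n∸1 : ∀ {m n} → m < n → m ≤ n ∸ 1
m<n⇒m≤n∸1 (s≤s m≤n) = m≤n

blockOf : ∀ {n} → Subset n → Fin n → Subset n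
blockOf S v with v ∈? S
... | yes _ = S
... | no  _ = ∁ S

∣blockOf-v∣≤∣S∣∸1 : ∀ {n} (S : Subset n) {v} → v ∈ S → ∣ blockOf S v - v ∣ ≤ ∣ S ∣ ∸ 1
∣blockOf-v∣≤∣S∣∸1 S {v} v∈S with v ∈? S
... | yes _   = m<n⇒m≤n∸1 (x∈p⇒∣p-x∣<∣p∣ v∈S)
... | no  v∉S = contradiction v∈S v∉S

∣blockOf-v∣≤n∸∣S∣∸1 : ∀ {n} (S : Subset n) {v} → v ∉ S → ∣ blockOf S v - v ∣ ≤ n ∸ ∣ S ∣ ∸ 1
∣blockOf-v∣≤n∸∣S∣∸1 S {v} v∉S with v ∈? S
... | yes v∈S = contradiction v∈S v∉S
... | no  _   = m<n⇒m≤n∸1 (subst (∣ ∁ S - v ∣ <_) (∣∁p∣≡n∸∣p∣ S) (x∈p⇒∣p-x∣<∣p∣ (x∉p⇒x∈∁p v∉S)))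

closed⇒choosesWithinBlocks : ∀ {n k} {c : Config n} {S} → Valid k c → Closed c S →
  ChoosesWithin k (λ v → blockOf S v - v) c
closed⇒choosesWithinBlocks {c = c} {S} valid closed v = choice⊆block , proj₂ (valid v)
  where
  ≢v : ∀ {w} → w ∈ lookup c v → w ≢ v
  ≢v w∈cv refl = proj₁ (valid v) w∈cv
  choice⊆block : lookup c v ⊆ blockOf S v - v
  choice⊆block {w} w∈cv with v ∈? S
  ... | yes v∈S = x∈p∧x≢y⇒x∈p-y (closed v∈S (inj₁ w∈cv)) (≢v w∈cv)
  ... | no  v∉S = x∈p∧x≢y⇒x∈p-y (x∉p⇒x∈∁p λ w∈S → v∉S (closed w∈S (inj₂ w∈cv))) (≢v w∈cv)

splitWeight : ℕ → ℕ → ℕ → ℕ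
splitWeight k s t = ((s ∸ 1) C k) ^ s * ((t ∸ 1) C k) ^ t

[m∸1]Ck^m≡0 : ∀ {m k} → 1 ≤ m → m ≤ k → ((m ∸ 1) C k) ^ m ≡ 0
[m∸1]Ck^m≡0 {suc m} {k} _ m<k = cong (_* (m C k) ^ m) (k>n⇒nCk≡0 m<k)

splitWeight≡0ˡ : ∀ {k s} t → 1 ≤ s → s ≤ k → splitWeight k s t ≡ 0
splitWeight≡0ˡ {k} t 1≤s s≤k = cong (_* ((t ∸ 1) C k) ^ t) ([m∸1]Ck^m≡0 1≤s s≤k)

splitWeight≡0ʳ : ∀ {k} s {t} → 1 ≤ t → t ≤ k → splitWeight k s t ≡ 0
splitWeight≡0ʳ {k} s 1≤t t≤k = trans (cong (((s ∸ 1) C k) ^ s *_) ([m∸1]Ck^m≡0 1≤t t≤k)) (*-zeroʳ (((s ∸ 1) C k) ^ s))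

length-filter-choosesWithinBlocks : ∀ {n} k (S : Subset n) →
  length (filter (choosesWithin? k (λ v → blockOf S v - v)) (allConfigs n)) ≤ splitWeight k ∣ S ∣ (n ∸ ∣ S ∣)
length-filter-choosesWithinBlocks k S = ≤-trans
  (≤-reflexive (length-filter-choosesWithin k (λ v → blockOf S v - v)))
  (∏-≤-split S (C-monoˡ-≤ k ∘ ∣blockOf-v∣≤∣S∣∸1 S) (C-monoˡ-≤ k ∘ ∣blockOf-v∣≤n∸∣S∣∸1 S))

properWeight : ℕ → ℕ → ℕ → ℕ
properWeight k n s with proper? n s
... | yes _ = splitWeight k s (n ∸ s)
... | no  _ = 0

length-disconnected≤ : ∀ {n} k (L : List (Config n)) → Unique L → All (λ c → Valid k c × ¬ Connected c) L →
  length L ≤ ∑[ s ∈ upTo (suc n) ] ((n C s) * properWeight k n s)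
length-disconnected≤ {n} k L L-unique disconnected = begin
  length L
    ≤⟨ length-mono-⊆-Unique L-unique L⊆badConfigs ⟩
  length (concatMap badConfigs properSubsets)
    ≡⟨ length-concatMap badConfigs properSubsets ⟩
  ∑[ S ∈ properSubsets ] length (badConfigs S)
    ≤⟨ ∑-filter≤ (proper? n ∘ ∣_∣) (allSubsets n) bad≤weight ⟩
  ∑[ S ∈ allSubsets n ] properWeight k n ∣ S ∣
    ≡⟨ ∑-allSubsets-bySize n ≤-refl (properWeight k n) ⟩
  ∑[ s ∈ upTo (suc n) ] ((n C s) * properWeight k n s) ∎
  where
  open ≤-Reasoning
  properSubsets = filter (proper? n ∘ ∣_∣) (allSubsets n)
  badConfigs : Subset n → List (Config n)
  badConfigs S = filter (choosesWithin? k (λ v → blockOf S v - v)) (allConfigs n)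
  bad≤weight : ∀ {S} → Proper n ∣ S ∣ → length (badConfigs S) ≤ properWeight k n ∣ S ∣
  bad≤weight {S} proper with proper? n ∣ S ∣
  ... | yes _ = length-filter-choosesWithinBlocks k S
  ... | no  ¬proper = contradiction proper ¬proper
  L⊆badConfigs : ∀ {c} → c List.∈ L → c List.∈ concatMap badConfigs properSubsets
  L⊆badConfigs {c} c∈L with All.lookup disconnected c∈L
  ... | valid , ¬connected with disconnected⇒closedProperSubset c ¬connected
  ... | S , proper , closed = ∈-concatMap⁺ badConfigs (lose
    (∈-filter⁺ (proper? n ∘ ∣_∣) (allSubsets-complete S) proper)
    (∈-filter⁺ (choosesWithin? k _) (allConfigs-complete c) (closed⇒choosesWithinBlocks {c = c} valid closed)))

-- The estimate for a fixed split

[s∸1]Ck*n^k≤s^k*[n∸1]Ck : ∀ k {s n} → 1 ≤ s → s ≤ n → ((s ∸ 1) C k) * n ^ k ≤ s ^ k * ((n ∸ 1) C k)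
[s∸1]Ck*n^k≤s^k*[n∸1]Ck k {suc a} {suc b} _ (s≤s a≤b) =
  subst₂ (λ x y → (a C k) * x ^ k ≤ y ^ k * (b C k)) (+-comm b 1) (+-comm a 1) (C-ratio k 1 a≤b)

[m^n]^o≡[m^o]^n : ∀ a b c → (a ^ b) ^ c ≡ (a ^ c) ^ b
[m^n]^o≡[m^o]^n a b c = trans (^-*-assoc a b c) (trans (cong (a ^_) (*-comm b c)) (sym (^-*-assoc a c b)))

a*x≤y⇒a^s*x^s≤y^s : ∀ {a x y} s → a * x ≤ y → a ^ s * x ^ s ≤ y ^ s
a*x≤y⇒a^s*x^s≤y^s {a} {x} {y} s a*x≤y = subst (_≤ y ^ s) (^-distribʳ-* a x s) (^-monoˡ-≤ s a*x≤y)

splitWeight*[n^k]^n≤[s^s*t^t]^k*T^n : ∀ k {s t} → 1 ≤ s → 1 ≤ t →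
  splitWeight k s t * ((s + t) ^ k) ^ (s + t) ≤ (s ^ s * t ^ t) ^ k * ((s + t ∸ 1) C k) ^ (s + t)
splitWeight*[n^k]^n≤[s^s*t^t]^k*T^n k {s} {t} 1≤s 1≤t = begin
  A ^ s * B ^ t * (n ^ k) ^ (s + t)                 ≡⟨ cong (A ^ s * B ^ t *_) (^-distribˡ-+-* (n ^ k) s t) ⟩
  A ^ s * B ^ t * ((n ^ k) ^ s * (n ^ k) ^ t)       ≡⟨ *-interchange (A ^ s) _ _ _ ⟩
  (A ^ s * (n ^ k) ^ s) * (B ^ t * (n ^ k) ^ t)     ≤⟨ *-mono-≤ (a*x≤y⇒a^s*x^s≤y^s s A≤) (a*x≤y⇒a^s*x^s≤y^s t B≤) ⟩
  (s ^ k * T) ^ s * (t ^ k * T) ^ t                 ≡⟨ cong₂ _*_ (^-distribʳ-* (s ^ k) T s) (^-distribʳ-* (t ^ k) T t) ⟩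
  (s ^ k) ^ s * T ^ s * ((t ^ k) ^ t * T ^ t)       ≡⟨ *-interchange ((s ^ k) ^ s) _ _ _ ⟩
  (s ^ k) ^ s * (t ^ k) ^ t * (T ^ s * T ^ t)       ≡⟨ cong₂ _*_ (cong₂ _*_ ([m^n]^o≡[m^o]^n s s k) ([m^n]^o≡[m^o]^n t t k)) (^-distribˡ-+-* T s t) ⟨
  (s ^ s) ^ k * (t ^ t) ^ k * T ^ (s + t)           ≡⟨ cong (_* T ^ (s + t)) (^-distribʳ-* (s ^ s) (t ^ t) k) ⟨
  (s ^ s * t ^ t) ^ k * T ^ (s + t)                 ∎
  where
  open ≤-Reasoning
  n = s + t
  A = (s ∸ 1) C k
  B = (t ∸ 1) C k
  T = (n ∸ 1) C k
  A≤ : A * n ^ k ≤ s ^ k * T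
  A≤ = [s∸1]Ck*n^k≤s^k*[n∸1]Ck k 1≤s (m≤m+n s t)
  B≤ : B * n ^ k ≤ t ^ k * T
  B≤ = [s∸1]Ck*n^k≤s^k*[n∸1]Ck k 1≤t (m≤n+m t s)

module _ (j : ℕ) {s t : ℕ} (1≤s : 1 ≤ s) (1≤t : 1 ≤ t) where

  private
    k = suc j
    n = s + t
    T = (n ∸ 1) C k
    W = splitWeight k s t
    h = s ^ s * t ^ t
    instance
      n≢0 : NonZero n
      n≢0 = >-nonZero (≤-trans 1≤s (m≤m+n s t))

  nCs*splitWeight*[n^n]^j≤[s^s*t^t]^j*T^n : (n C s) * W * (n ^ n) ^ j ≤ h ^ j * T ^ n
  nCs*splitWeight*[n^n]^j≤[s^s*t^t]^j*T^n = *-cancelʳ-≤ _ _ (n ^ n) {{m^n≢0 n n}} (begin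
    (n C s) * W * (n ^ n) ^ j * n ^ n     ≡⟨ *-assoc ((n C s) * W) _ _ ⟩
    (n C s) * W * ((n ^ n) ^ j * n ^ n)   ≡⟨ cong ((n C s) * W *_) (trans (*-comm ((n ^ n) ^ j) _) ([m^n]^o≡[m^o]^n n n k)) ⟩
    (n C s) * W * (n ^ k) ^ n             ≡⟨ *-assoc (n C s) W _ ⟩
    (n C s) * (W * (n ^ k) ^ n)           ≤⟨ *-monoʳ-≤ (n C s) (splitWeight*[n^k]^n≤[s^s*t^t]^k*T^n k 1≤s 1≤t) ⟩
    (n C s) * (h * h ^ j * T ^ n)         ≡⟨ trans (cong ((n C s) *_) (*-assoc h _ _)) (sym (*-assoc (n C s) h _)) ⟩
    (n C s) * h * (h ^ j * T ^ n)         ≤⟨ *-monoˡ-≤ (h ^ j * T ^ n) binomial-term ⟩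
    n ^ n * (h ^ j * T ^ n)               ≡⟨ *-comm (n ^ n) _ ⟩
    h ^ j * T ^ n * n ^ n                 ∎)
    where
    open ≤-Reasoning
    binomial-term : (n C s) * h ≤ n ^ n
    binomial-term = subst (λ r → (n C s) * (s ^ s * t ^ r) ≤ n ^ n) (m+n∸m≡n s t)
      (nCs*a^s*b^[n∸s]≤[a+b]^n s t (m≤m+n s t))

  nCs*splitWeight*[n^q]^j≤[q^q*2^q]^j*T^n : ∀ {q} → q ≤ s → q ≤ t →
    (n C s) * W * (n ^ q) ^ j ≤ (q ^ q * 2 ^ q) ^ j * T ^ n
  nCs*splitWeight*[n^q]^j≤[q^q*2^q]^j*T^n {q} q≤s q≤t =
    *-cancelʳ-≤ _ _ ((n ^ n) ^ j) {{m^n≢0 (n ^ n) j {{m^n≢0 n n}}}} (begin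
      (n C s) * W * (n ^ q) ^ j * (n ^ n) ^ j   ≡⟨ x*y*z≡x*z*y ((n C s) * W) _ _ ⟩
      (n C s) * W * (n ^ n) ^ j * (n ^ q) ^ j   ≤⟨ *-monoˡ-≤ ((n ^ q) ^ j) nCs*splitWeight*[n^n]^j≤[s^s*t^t]^j*T^n ⟩
      h ^ j * T ^ n * (n ^ q) ^ j               ≡⟨ trans (x*y*z≡x*z*y (h ^ j) _ _) (cong (_* T ^ n) (sym (^-distribʳ-* h (n ^ q) j))) ⟩
      (h * n ^ q) ^ j * T ^ n                   ≤⟨ *-monoˡ-≤ (T ^ n) (^-monoˡ-≤ j (s^s*t^t*[s+t]^p≤p^p*2^p*[s+t]^[s+t] q≤s q≤t)) ⟩
      (q ^ q * 2 ^ q * n ^ n) ^ j * T ^ n       ≡⟨ cong (_* T ^ n) (^-distribʳ-* (q ^ q * 2 ^ q) (n ^ n) j) ⟩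
      (q ^ q * 2 ^ q) ^ j * (n ^ n) ^ j * T ^ n ≡⟨ x*y*z≡x*z*y ((q ^ q * 2 ^ q) ^ j) _ _ ⟩
      (q ^ q * 2 ^ q) ^ j * T ^ n * (n ^ n) ^ j ∎)
    where open ≤-Reasoning

entropyConstant : ℕ → ℕ
entropyConstant q = q ^ q * 2 ^ q

[n^[1+k]]^j≡n^[j*[k+1]] : ∀ n k j → (n ^ suc k) ^ j ≡ n ^ (j * (k + 1))
[n^[1+k]]^j≡n^[j*[k+1]] n k j = trans (^-*-assoc n (suc k) j) (cong (n ^_) (trans (*-comm (suc k) j) (cong (j *_) (+-comm 1 k))))

n^[j*[k+1]]*n≤[n^[2+k]]^j : ∀ {n j} k → .{{NonZero n}} → 1 ≤ j → n ^ (j * (k + 1)) * n ≤ (n ^ suc (suc k)) ^ j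
n^[j*[k+1]]*n≤[n^[2+k]]^j {n} {suc j} k _ = begin
  n ^ (suc j * (k + 1)) * n              ≡⟨ cong (_* n) ([n^[1+k]]^j≡n^[j*[k+1]] n k (suc j)) ⟨
  (n ^ suc k) ^ suc j * n                ≡⟨ *-comm _ n ⟩
  n * (n ^ suc k) ^ suc j                ≤⟨ *-monoˡ-≤ _ (m≤m*n n (n ^ j) {{m^n≢0 n j}}) ⟩
  n ^ suc j * (n ^ suc k) ^ suc j        ≡⟨ ^-distribʳ-* n (n ^ suc k) (suc j) ⟨
  (n ^ suc (suc k)) ^ suc j              ∎
  where open ≤-Reasoning

-- Sizes with a side of at most k = j + 1 vertices carry no weight. A side of exactly k + 1
-- vertices only allows q = k + 1 in the entropy bound, and this happens for at most two sizes s.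
sizeBudget : ℕ → ℕ → ℕ → ℕ
sizeBudget j n s = entropyConstant (3 + j) ^ j + entropyConstant (2 + j) ^ j * n * (δ s (2 + j) + δ (s + (2 + j)) n)

module _ (j : ℕ) (1≤j : 1 ≤ j) {s t : ℕ} (1≤s : 1 ≤ s) (1≤t : 1 ≤ t) where

  private
    k = suc j
    n = s + t
    e = j * (k + 1)
    T = (n ∸ 1) C k
    W = splitWeight k s t
    D = entropyConstant (suc k)
    K = entropyConstant (suc (suc k))

    vanishing : W ≡ 0 → (n C s) * W * (n ^ e * n) ≤ T ^ n * sizeBudget j n s
    vanishing W≡0 = ≤-trans (≤-reflexive (trans (cong (λ w → (n C s) * w * (n ^ e * n)) W≡0)
      (cong (_* (n ^ e * n)) (*-zeroʳ (n C s))))) z≤n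

    edge : k < s → k < t → 1 ≤ δ s (suc k) + δ (s + suc k) n → (n C s) * W * (n ^ e * n) ≤ T ^ n * sizeBudget j n s
    edge k<s k<t 1≤δ = begin
      (n C s) * W * (n ^ e * n)          ≡⟨ *-assoc ((n C s) * W) _ _ ⟨
      (n C s) * W * n ^ e * n            ≡⟨ cong (λ x → (n C s) * W * x * n) ([n^[1+k]]^j≡n^[j*[k+1]] n k j) ⟨
      (n C s) * W * (n ^ suc k) ^ j * n  ≤⟨ *-monoˡ-≤ n (nCs*splitWeight*[n^q]^j≤[q^q*2^q]^j*T^n j 1≤s 1≤t k<s k<t) ⟩
      D ^ j * T ^ n * n                  ≡⟨ trans (x*y*z≡x*z*y (D ^ j) _ _) (*-comm _ (T ^ n)) ⟩
      T ^ n * (D ^ j * n)                ≤⟨ *-monoʳ-≤ (T ^ n) (m≤m*n (D ^ j * n) _ {{>-nonZero 1≤δ}}) ⟩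
      T ^ n * (D ^ j * n * _)            ≤⟨ *-monoʳ-≤ (T ^ n) (m≤n+m _ (K ^ j)) ⟩
      T ^ n * sizeBudget j n s           ∎
      where open ≤-Reasoning

    bulk : suc k < s → suc k < t → (n C s) * W * (n ^ e * n) ≤ T ^ n * sizeBudget j n s
    bulk 1+k<s 1+k<t = begin
      (n C s) * W * (n ^ e * n)                ≤⟨ *-monoʳ-≤ ((n C s) * W) (n^[j*[k+1]]*n≤[n^[2+k]]^j k 1≤j) ⟩
      (n C s) * W * (n ^ suc (suc k)) ^ j      ≤⟨ nCs*splitWeight*[n^q]^j≤[q^q*2^q]^j*T^n j 1≤s 1≤t 1+k<s 1+k<t ⟩
      K ^ j * T ^ n                            ≡⟨ *-comm (K ^ j) _ ⟩
      T ^ n * K ^ j                            ≤⟨ *-monoʳ-≤ (T ^ n) (m≤m+n (K ^ j) _) ⟩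
      T ^ n * sizeBudget j n s                 ∎
      where
      open ≤-Reasoning
      instance
        n≢0 : NonZero n
        n≢0 = >-nonZero (≤-trans 1≤s (m≤m+n s t))

  nCs*splitWeight*n^e≤T^n*sizeBudget : (n C s) * W * (n ^ e * n) ≤ T ^ n * sizeBudget j n s
  nCs*splitWeight*n^e≤T^n*sizeBudget with suc k ≤? s | suc k ≤? t
  ... | no k≮s  | _       = vanishing (splitWeight≡0ˡ t 1≤s (≤-pred (≰⇒> k≮s)))
  ... | yes _   | no k≮t  = vanishing (splitWeight≡0ʳ s 1≤t (≤-pred (≰⇒> k≮t)))
  ... | yes k<s | yes k<t with suc k ℕ.≟ s | suc k ℕ.≟ t
  ...   | yes 1+k≡s | _         = edge k<s k<t (≤-trans (≤-reflexive (sym (≡⇒δ≡1 (sym 1+k≡s)))) (m≤m+n _ _))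
  ...   | no _      | yes 1+k≡t = edge k<s k<t (≤-trans (≤-reflexive (sym (≡⇒δ≡1 (cong (s +_) 1+k≡t)))) (m≤n+m _ _))
  ...   | no 1+k≢s  | no 1+k≢t  = bulk (≤∧≢⇒< k<s 1+k≢s) (≤∧≢⇒< k<t 1+k≢t)

nCs*properWeight*n^e≤T^n*sizeBudget : ∀ j → 1 ≤ j → ∀ n s →
  (n C s) * properWeight (suc j) n s * (n ^ (j * (suc j + 1)) * n) ≤ ((n ∸ 1) C suc j) ^ n * sizeBudget j n s
nCs*properWeight*n^e≤T^n*sizeBudget j 1≤j n s with proper? n s
... | no  _ = ≤-trans (≤-reflexive (cong (_* (n ^ (j * (suc j + 1)) * n)) (*-zeroʳ (n C s)))) z≤n
... | yes (1≤s , s<n) = subst (λ m → (m C s) * splitWeight (suc j) s (n ∸ s) * (m ^ (j * (suc j + 1)) * m) ≤ ((m ∸ 1) C suc j) ^ m * sizeBudget j m s)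
  (m+[n∸m]≡n (<⇒≤ s<n)) (nCs*splitWeight*n^e≤T^n*sizeBudget j 1≤j 1≤s (m<n⇒0<n∸m s<n))

disconnectedConstant : ℕ → ℕ
disconnectedConstant j = 2 * entropyConstant (3 + j) ^ j + 2 * entropyConstant (2 + j) ^ j

∑-sizeBudget≤ : ∀ j n → 1 ≤ n → ∑[ s ∈ upTo (suc n) ] sizeBudget j n s ≤ n * disconnectedConstant j
∑-sizeBudget≤ j n 1≤n = begin
  ∑[ s ∈ sizes ] (K + D * n * (δ s (2 + j) + δ (s + (2 + j)) n))
    ≡⟨ ∑-+ sizes (λ _ → K) (λ s → D * n * (δ s (2 + j) + δ (s + (2 + j)) n)) ⟩
  ∑[ s ∈ sizes ] K + ∑[ s ∈ sizes ] (D * n * (δ s (2 + j) + δ (s + (2 + j)) n))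
    ≡⟨ cong₂ _+_ (∑-const sizes K) (sym (*-distribˡ-∑ (D * n) sizes _)) ⟩
  length sizes * K + D * n * ∑[ s ∈ sizes ] (δ s (2 + j) + δ (s + (2 + j)) n)
    ≡⟨ cong₂ (λ l x → l * K + D * n * x) (length-upTo (suc n)) (∑-+ sizes (λ s → δ s (2 + j)) (λ s → δ (s + (2 + j)) n)) ⟩
  suc n * K + D * n * (∑[ s ∈ sizes ] δ s (2 + j) + ∑[ s ∈ sizes ] δ (s + (2 + j)) n)
    ≤⟨ +-mono-≤ (*-monoˡ-≤ K (+-monoˡ-≤ n 1≤n)) (*-monoʳ-≤ (D * n) (+-mono-≤ (∑-δ≤1 (2 + j) (upTo⁺ (suc n))) shifted≤1)) ⟩
  (n + n) * K + D * n * 2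
    ≡⟨ regroup n K D ⟩
  n * (2 * K + 2 * D) ∎
  where
  open ≤-Reasoning
  sizes = upTo (suc n)
  K = entropyConstant (3 + j) ^ j
  D = entropyConstant (2 + j) ^ j
  shifted≤1 : ∑[ s ∈ sizes ] δ (s + (2 + j)) n ≤ 1
  shifted≤1 = subst (_≤ 1) (∑-map (_+ (2 + j)) sizes (λ m → δ m n)) (∑-δ≤1 n (map⁺ (+-cancelʳ-≡ _ _ _) (upTo⁺ (suc n))))
  regroup : ∀ n K D → (n + n) * K + D * n * 2 ≡ n * (2 * K + 2 * D)
  regroup = solve-∀

length-disconnected*n^e≤C*#valid : ∀ j → 1 ≤ j → ∀ n (L : List (Config n)) → Unique L →
  All (λ c → Valid (suc j) c × ¬ Connected c) L →
  length L * n ^ (j * (suc j + 1)) ≤ disconnectedConstant j * length (filter (valid? (suc j)) (allConfigs n))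
length-disconnected*n^e≤C*#valid (suc j) _ zero L _ _ = ≤-trans (≤-reflexive (*-zeroʳ (length L))) z≤n
length-disconnected*n^e≤C*#valid j 1≤j n@(suc _) L L-unique L-disconnected =
  subst (λ v → length L * n ^ e ≤ κ * v) (sym (length-filter-valid n k))
    (*-cancelʳ-≤ (length L * n ^ e) (κ * T ^ n) n (begin
      length L * n ^ e * n                                         ≡⟨ *-assoc (length L) _ _ ⟩
      length L * (n ^ e * n)                                       ≤⟨ *-monoˡ-≤ (n ^ e * n) (length-disconnected≤ k L L-unique L-disconnected) ⟩
      ∑[ s ∈ sizes ] ((n C s) * properWeight k n s) * (n ^ e * n)  ≡⟨ trans (*-comm _ (n ^ e * n)) (*-distribˡ-∑ (n ^ e * n) sizes _) ⟩
      ∑[ s ∈ sizes ] (n ^ e * n * ((n C s) * properWeight k n s))  ≤⟨ ∑-mono sizes (λ s → ≤-trans (≤-reflexive (*-comm (n ^ e * n) _)) (nCs*properWeight*n^e≤T^n*sizeBudget j 1≤j n s)) ⟩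
      ∑[ s ∈ sizes ] (T ^ n * sizeBudget j n s)                    ≡⟨ *-distribˡ-∑ (T ^ n) sizes (sizeBudget j n) ⟨
      T ^ n * ∑[ s ∈ sizes ] sizeBudget j n s                      ≤⟨ *-monoʳ-≤ (T ^ n) (∑-sizeBudget≤ j n (s≤s z≤n)) ⟩
      T ^ n * (n * κ)                                              ≡⟨ trans (*-comm (T ^ n) _) (trans (*-assoc n κ _) (*-comm n _)) ⟩
      κ * T ^ n * n                                                ∎))
  where
  open ≤-Reasoning
  k = suc j
  e = j * (suc j + 1)
  κ = disconnectedConstant j
  T = (n ∸ 1) C k
  sizes = upTo (suc n)

lemma8 : (k : ℕ) → 1 ≤ k → ∃[ C ] ((n : ℕ) → (L : List (Config n)) → Unique L → All (λ c → Valid k c × ¬ Connected c) L → length L * n ^ ((k ∸ 1) * (k + 1)) ≤ C * length (filter (valid? k) (allConfigs n)))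
lemma8 (suc zero) _ = 1 , λ n L L-unique L-disconnected → begin
  length L * 1                                   ≡⟨ *-identityʳ (length L) ⟩
  length L                                       ≤⟨ length-mono-⊆-Unique L-unique (λ c∈L → ∈-filter⁺ (valid? 1) (allConfigs-complete _) (proj₁ (All.lookup L-disconnected c∈L))) ⟩
  length (filter (valid? 1) (allConfigs n))      ≡⟨ *-identityˡ _ ⟨
  1 * length (filter (valid? 1) (allConfigs n))  ∎
  where open ≤-Reasoning
lemma8 (suc (suc j)) _ = disconnectedConstant (suc j) , length-disconnected*n^e≤C*#valid (suc j) (s≤s z≤n)
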